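{- For every integer $n\ge 0$, there is a bijection between the set of isomorphism classes of minimal set covers of an $n$-element set and the set of isomorphism classes of bipartite posets on $n$ elements which maps unbalanced minimal set covers to unbalanced bipartite posets and balanced minimal set covers to balanced bipartite posets.
   Context: A set cover of a finite set $V$ is a collection $\mathcal{C}$ of subsets of $V$ whose union is $V$; it is minimal if no member is contained in the union of the others. A minimal set cover is unbalanced if it contains a set of cardinality $|V|-|\mathcal{C}|+1$, and balanced otherwise. Set covers are identified under bijections of ground sets carrying members onto members. A bipartite poset is a finite poset of height at most one (no $x\prec y\prec z$). An element $v$ has height 1 if some $u\prec v$, height 0 otherwise; a height-0 element is a full support point if it is comparable to every height-1 element. A bipartite poset is unbalanced if it has a full support point and balanced otherwise. Posets are considered up to isomorphism. -}

module Defs where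

open import Data.Nat using (ℕ; _+_)
open import Data.Bool using (Bool; T)
open import Data.Fin using (Fin)
open import Data.Fin.Subset using (Subset; _∈_; _∉_; _⊆_; ∣_∣)
open import Data.Product using (Σ; ∃; ∃-syntax; _×_; _,_)
open import Data.Sum using (_⊎_)
open import Data.Empty using (⊥)
open import Relation.Nullary using (¬_)
open import Relation.Binary.PropositionalEquality using (_≡_; _≢_)
open import Function.Bundles using (_↔_; Inverse)

record MinSetCover (n : ℕ) : Set where
  field
    m      : ℕ
    member : Fin m → Subset n
    covers : ∀ (x : Fin n) → ∃[ i ] (x ∈ member i)
    minimal : ∀ (i : Fin m) →
      ¬ (∀ (x : Fin n) → x ∈ member i → ∃[ j ] (j ≢ i × x ∈ member j))

open MinSetCover public

CoverIso : ∀ {n} → MinSetCover n → MinSetCover n → Set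
CoverIso {n} C D =
  Σ (Fin n ↔ Fin n) λ σ →
  Σ (Fin (m C) ↔ Fin (m D)) λ τ →
    ∀ (i : Fin (m C)) (x : Fin n) →
      (x ∈ member C i → Inverse.to σ x ∈ member D (Inverse.to τ i)) ×
      (Inverse.to σ x ∈ member D (Inverse.to τ i) → x ∈ member C i)

UnbalancedCover : ∀ {n} → MinSetCover n → Set
UnbalancedCover {n} C = ∃[ i ] (∣ member C i ∣ + m C ≡ n + 1)

BalancedCover : ∀ {n} → MinSetCover n → Set
BalancedCover C = ¬ UnbalancedCover C

record BipartitePoset (n : ℕ) : Set where
  field
    le      : Fin n → Fin n → Bool
    reflexive : ∀ x → T (le x x)
    antisym : ∀ x y → T (le x y) → T (le y x) → x ≡ y
    trans   : ∀ x y z → T (le x y) → T (le y z) → T (le x z)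

  _≺_ : Fin n → Fin n → Set
  x ≺ y = T (le x y) × x ≢ y

  field
    height≤1 : ∀ x y z → x ≺ y → y ≺ z → ⊥

open BipartitePoset public

Height1 : ∀ {n} → BipartitePoset n → Fin n → Set
Height1 P v = ∃[ u ] (_≺_ P u v)

Height0 : ∀ {n} → BipartitePoset n → Fin n → Set
Height0 P v = ¬ Height1 P v

Comparable : ∀ {n} → BipartitePoset n → Fin n → Fin n → Set
Comparable P x y = T (le P x y) ⊎ T (le P y x)

FullSupportPoint : ∀ {n} → BipartitePoset n → Fin n → Set
FullSupportPoint P v = Height0 P v × (∀ w → Height1 P w → Comparable P v w)

UnbalancedPoset : ∀ {n} → BipartitePoset n → Set
UnbalancedPoset P = ∃[ v ] FullSupportPoint P v

BalancedPoset : ∀ {n} → BipartitePoset n → Set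
BalancedPoset P = ¬ UnbalancedPoset P

PosetIso : ∀ {n} → BipartitePoset n → BipartitePoset n → Set
PosetIso {n} P Q =
  Σ (Fin n ↔ Fin n) λ σ →
    ∀ x y → le P x y ≡ le Q (Inverse.to σ x) (Inverse.to σ y)

module Submission where

-- Every member C_i of a minimal cover has a private element r_i, lying in
-- no other member; a choice of them is a transversal. A cover with a
-- transversal determines the bipartite poset
--     x ≼ y  ⟺  x = y, or x = r_i and y ∈ C_i for some i,
-- whose minimal elements are the r_i and in which the up-set of r_i is C_i.
-- The map F sends a cover to this poset for a canonical transversal.
-- After counting lemmas for subsets of Fin n, an enumeration of decidable
-- predicates and generalities on poset isomorphisms, we study this poset:
--   * a cover isomorphism transports transversals, and exchanging r_i with
--     another private element r'_i is an isomorphism, so F respects ≅;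
--   * a poset isomorphism preserves minimal elements and up-sets, so it is
--     already a cover isomorphism;
--   * the up-sets of the height-0 points of a bipartite poset P form a
--     minimal cover whose poset is P;
--   * |C_i| + |C| = n + 1 iff C_i and the r_j together exhaust V iff r_i
--     is a full support point.

open import Defs
open import Level using (0ℓ)
open import Data.Nat using (ℕ; zero; suc; _+_)
import Data.Nat.Properties as ℕ
open import Data.Bool using (Bool; true; false; T)
open import Data.Bool.Properties using (T-≡; T?)
open import Data.Unit using (tt)
open import Data.Empty using (⊥; ⊥-elim)
open import Data.Product using (Σ; ∃; ∃-syntax; _×_; _,_; proj₁; proj₂)
open import Data.Sum using (_⊎_; inj₁; inj₂; [_,_]; map₂)
open import Data.Fin using (Fin; zero; suc; punchIn; punchOut; _≟_)
open import Data.Fin.Properties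
  using (any?; ¬∀⟶∃¬; suc-injective; 0≢1+n; punchIn-injective; punchInᵢ≢i; punchIn-punchOut)
open import Data.Fin.Subset using (Subset; _∈_; _∉_; ∣_∣; _∪_; ⁅_⁆) renaming (⊥ to ∅)
open import Data.Fin.Subset.Properties
  using (_∈?_; x∈p∪q⁻; x∈p∪q⁺; ∣p∣≡n⇒p≡⊤; ∣⊤∣≡n; ∣⊥∣≡0; ∉⊥; x∈⁅y⁆⇒x≡y; x∈⁅x⁆; ∈⊤;
         ⊆-antisym; ∣⁅x⁆∣≡1)
open import Data.Vec using (_∷_; []; here; there; tabulate)
open import Data.Vec.Properties using (lookup∘tabulate; []=⇒lookup; lookup⇒[]=)
open import Data.List using (List; _∷_; filter; allFin; length; lookup)
import Data.List.Relation.Unary.All as All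
open import Data.List.Relation.Unary.AllPairs using (_∷_)
open import Data.List.Relation.Unary.Any using (index)
open import Data.List.Membership.Propositional using () renaming (_∈_ to _∈ₗ_)
open import Data.List.Relation.Unary.Any.Properties using (lookup-index)
open import Data.List.Relation.Unary.Unique.Propositional using (Unique)
open import Data.List.Relation.Unary.Unique.Propositional.Properties using (filter⁺; allFin⁺)
open import Data.List.Membership.Propositional.Properties
  using (∈-filter⁺; ∈-filter⁻; ∈-lookup; ∈-allFin)
open import Function using (_∘_)
open import Function.Bundles using (_⇔_; _↔_; mk⇔; mk↔ₛ′; Inverse; Equivalence; Injection)
open import Function.Definitions using (Injective)
open import Function.Properties.Inverse using (↔⇒↣)
open import Function.Properties.Equivalence using (⇔-setoid)
open import Function.Construct.Composition using (_↔-∘_)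
open import Function.Construct.Symmetry using (↔-sym)
open import Function.Construct.Identity using (↔-id)
open import Function.Related.TypeIsomorphisms using (¬-cong-⇔)
open import Relation.Nullary using (¬_; Dec; yes; no; _⊎-dec_; _×-dec_; _→-dec_; ¬?)
open import Relation.Nullary.Decidable using (isYes; toWitness; fromWitness; decidable-stable)
open import Relation.Unary using (Decidable)
open import Relation.Binary.PropositionalEquality
  using (_≡_; _≢_; refl; sym; cong; cong₂; subst; module ≡-Reasoning)
  renaming (trans to ≡-trans)
import Relation.Binary.Reasoning.Setoid as SetoidReasoning

open Inverse using (to; from; strictlyInverseˡ; strictlyInverseʳ)
open Equivalence using () renaming (to to forward; from to backward)

module ⇔-Reasoning = SetoidReasoning (⇔-setoid 0ℓ)

T-injective : ∀ {a b} → T a ⇔ T b → a ≡ b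
T-injective {false} {false} _ = refl
T-injective {false} {true}  a⇔b = ⊥-elim (backward a⇔b tt)
T-injective {true}  {false} a⇔b = ⊥-elim (forward a⇔b tt)
T-injective {true}  {true}  _ = refl

↔-injective : ∀ {A B : Set} (f : A ↔ B) → Injective _≡_ _≡_ (to f)
↔-injective f = Injection.injective (↔⇒↣ f)

∈-tabulate : ∀ {n} (f : Fin n → Bool) x → x ∈ tabulate f ⇔ T (f x)
∈-tabulate f x = mk⇔
  (λ x∈ → backward T-≡ (≡-trans (sym (lookup∘tabulate f x)) ([]=⇒lookup x∈)))
  (λ fx → lookup⇒[]= x (tabulate f) (≡-trans (lookup∘tabulate f x) (forward T-≡ fx)))

-- Counting in subsets of Fin n.

Disjoint : ∀ {n} → Subset n → Subset n → Set
Disjoint p q = ∀ {x} → x ∈ p → x ∉ q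

disjoint-tail : ∀ {n a b} {p q : Subset n} → Disjoint (a ∷ p) (b ∷ q) → Disjoint p q
disjoint-tail disj x∈p x∈q = disj (there x∈p) (there x∈q)

∣p∪q∣≡∣p∣+∣q∣ : ∀ {n} (p q : Subset n) → Disjoint p q → ∣ p ∪ q ∣ ≡ ∣ p ∣ + ∣ q ∣
∣p∪q∣≡∣p∣+∣q∣ [] [] _ = refl
∣p∪q∣≡∣p∣+∣q∣ (true ∷ p) (true ∷ q) disj = ⊥-elim (disj here here)
∣p∪q∣≡∣p∣+∣q∣ (true ∷ p) (false ∷ q) disj = cong suc (∣p∪q∣≡∣p∣+∣q∣ p q (disjoint-tail disj))
∣p∪q∣≡∣p∣+∣q∣ (false ∷ p) (true ∷ q) disj =
  ≡-trans (cong suc (∣p∪q∣≡∣p∣+∣q∣ p q (disjoint-tail disj))) (sym (ℕ.+-suc ∣ p ∣ ∣ q ∣))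
∣p∪q∣≡∣p∣+∣q∣ (false ∷ p) (false ∷ q) disj = ∣p∪q∣≡∣p∣+∣q∣ p q (disjoint-tail disj)

image : ∀ {n k} → (Fin k → Fin n) → Subset n
image {k = zero}  g = ∅
image {k = suc k} g = ⁅ g zero ⁆ ∪ image (g ∘ suc)

∈-image⁺ : ∀ {n k} (g : Fin k → Fin n) j → g j ∈ image g
∈-image⁺ g zero    = x∈p∪q⁺ (inj₁ (x∈⁅x⁆ (g zero)))
∈-image⁺ g (suc j) = x∈p∪q⁺ {p = ⁅ g zero ⁆} (inj₂ (∈-image⁺ (g ∘ suc) j))

∈-image⁻ : ∀ {n k} (g : Fin k → Fin n) {x} → x ∈ image g → ∃[ j ] (g j ≡ x)
∈-image⁻ {k = zero}  g x∈ = ⊥-elim (∉⊥ x∈)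
∈-image⁻ {k = suc k} g x∈ with x∈p∪q⁻ ⁅ g zero ⁆ (image (g ∘ suc)) x∈
... | inj₁ x∈g₀ = zero , sym (x∈⁅y⁆⇒x≡y (g zero) x∈g₀)
... | inj₂ x∈rest with ∈-image⁻ (g ∘ suc) x∈rest
...   | j , gj≡x = suc j , gj≡x

∣image∣ : ∀ {n k} (g : Fin k → Fin n) → Injective _≡_ _≡_ g → ∣ image g ∣ ≡ k
∣image∣ {n} {zero} g _ = ∣⊥∣≡0 n
∣image∣ {k = suc k} g inj = begin
  ∣ ⁅ g zero ⁆ ∪ image (g ∘ suc) ∣    ≡⟨ ∣p∪q∣≡∣p∣+∣q∣ _ _ head-new ⟩
  ∣ ⁅ g zero ⁆ ∣ + ∣ image (g ∘ suc) ∣ ≡⟨ cong₂ _+_ (∣⁅x⁆∣≡1 (g zero)) (∣image∣ (g ∘ suc) tail-injective) ⟩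
  suc k                               ∎
  where
  open ≡-Reasoning
  tail-injective : Injective _≡_ _≡_ (g ∘ suc)
  tail-injective = suc-injective ∘ inj
  head-new : Disjoint ⁅ g zero ⁆ (image (g ∘ suc))
  head-new x∈g₀ x∈rest with ∈-image⁻ (g ∘ suc) x∈rest
  ... | j , gj≡x = 0≢1+n (inj (≡-trans (sym (x∈⁅y⁆⇒x≡y (g zero) x∈g₀)) (sym gj≡x)))

∣p∣≡n⇔full : ∀ {n} (p : Subset n) → ∣ p ∣ ≡ n ⇔ (∀ x → x ∈ p)
∣p∣≡n⇔full {n} p = mk⇔
  (λ ∣p∣≡n x → subst (x ∈_) (sym (∣p∣≡n⇒p≡⊤ ∣p∣≡n)) ∈⊤)
  (λ full → ≡-trans (cong ∣_∣ (⊆-antisym (λ _ → ∈⊤) (λ {x} _ → full x))) (∣⊤∣≡n n))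

exhausts⇔ : ∀ {n k} (p : Subset n) (g : Fin k → Fin n) → Injective _≡_ _≡_ g →
  (∀ j → g j ∉ p) → ∣ p ∣ + k ≡ n ⇔ (∀ x → x ∈ p ⊎ ∃[ j ] (g j ≡ x))
exhausts⇔ {n} {k} p g inj avoids = begin
  (∣ p ∣ + k ≡ n)                       ≡⟨ cong (_≡ n) size ⟨
  (∣ p ∪ image g ∣ ≡ n)                 ≈⟨ ∣p∣≡n⇔full (p ∪ image g) ⟩
  (∀ x → x ∈ p ∪ image g)               ≈⟨ pointwise ⟩
  (∀ x → x ∈ p ⊎ ∃[ j ] (g j ≡ x))     ∎
  where
  open ⇔-Reasoning
  disjoint : Disjoint p (image g)
  disjoint x∈p x∈img with ∈-image⁻ g x∈img
  ... | j , gj≡x = avoids j (subst (_∈ p) (sym gj≡x) x∈p)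
  size : ∣ p ∪ image g ∣ ≡ ∣ p ∣ + k
  size = ≡-trans (∣p∪q∣≡∣p∣+∣q∣ p (image g) disjoint) (cong (∣ p ∣ +_) (∣image∣ g inj))
  pointwise : (∀ x → x ∈ p ∪ image g) ⇔ (∀ x → x ∈ p ⊎ ∃[ j ] (g j ≡ x))
  pointwise = mk⇔
    (λ full x → map₂ (∈-image⁻ g) (x∈p∪q⁻ p (image g) (full x)))
    (λ cover x → x∈p∪q⁺ (map₂ (λ { (j , refl) → ∈-image⁺ g j }) (cover x)))

-- The counting behind balance: if each r_i lies in mem i and in no other
-- member, then ∣ mem i ∣ + m = n + 1 exactly when mem i together with the
-- points r_j exhausts Fin n (mem i and the other m - 1 points r_j are disjoint).
member-size⇔ : ∀ {n m} (mem : Fin m → Subset n) (r : Fin m → Fin n) →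
  (∀ i → r i ∈ mem i) → (∀ i j → r i ∈ mem j → j ≡ i) →
  ∀ i → ∣ mem i ∣ + m ≡ n + 1 ⇔ (∀ x → x ∈ mem i ⊎ ∃[ j ] (r j ≡ x))
member-size⇔ {n} {suc m} mem r r∈ r-private i = begin
  (∣ mem i ∣ + suc m ≡ n + 1)                ≈⟨ drop-suc ⟩
  (∣ mem i ∣ + m ≡ n)                        ≈⟨ exhausts⇔ (mem i) others others-injective others-outside ⟩
  (∀ x → x ∈ mem i ⊎ ∃[ j ] (others j ≡ x)) ≈⟨ pointwise ⟩
  (∀ x → x ∈ mem i ⊎ ∃[ j ] (r j ≡ x))      ∎
  where
  open ⇔-Reasoning
  drop-suc : ∣ mem i ∣ + suc m ≡ n + 1 ⇔ ∣ mem i ∣ + m ≡ n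
  drop-suc = mk⇔
    (λ e → ℕ.suc-injective (≡-trans (sym (ℕ.+-suc ∣ mem i ∣ m)) (≡-trans e (ℕ.+-comm n 1))))
    (λ e → ≡-trans (ℕ.+-suc ∣ mem i ∣ m) (≡-trans (cong suc e) (ℕ.+-comm 1 n)))
  others : Fin m → Fin n
  others = r ∘ punchIn i
  others-injective : Injective _≡_ _≡_ others
  others-injective {a} {b} e = punchIn-injective i a b
    (r-private (punchIn i b) (punchIn i a) (subst (_∈ mem (punchIn i a)) e (r∈ (punchIn i a))))
  others-outside : ∀ j → others j ∉ mem i
  others-outside j rj∈i = punchInᵢ≢i i j (sym (r-private (punchIn i j) i rj∈i))
  covered : ∀ x j → r j ≡ x → x ∈ mem i ⊎ ∃[ j′ ] (others j′ ≡ x)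
  covered x j rj≡x with i ≟ j
  ... | yes refl = inj₁ (subst (_∈ mem i) rj≡x (r∈ i))
  ... | no i≢j = inj₂ (punchOut i≢j , ≡-trans (cong r (punchIn-punchOut i≢j)) rj≡x)
  pointwise : (∀ x → x ∈ mem i ⊎ ∃[ j ] (others j ≡ x)) ⇔ (∀ x → x ∈ mem i ⊎ ∃[ j ] (r j ≡ x))
  pointwise = mk⇔
    (λ cover x → map₂ (λ { (j , e) → punchIn i j , e }) (cover x))
    (λ cover x → [ inj₁ , (λ { (j , e) → covered x j e }) ] (cover x))

-- Enumerating the points of Fin n that satisfy a decidable predicate.

record Enumeration {n} (Q : Fin n → Set) : Set where
  field
    size            : ℕ
    point           : Fin size → Fin n
    point-injective : Injective _≡_ _≡_ point
    point-sound     : ∀ j → Q (point j)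
    point-complete  : ∀ x → Q x → ∃[ j ] (point j ≡ x)

lookup-injective : ∀ {A : Set} {xs : List A} → Unique xs → Injective _≡_ _≡_ (lookup xs)
lookup-injective {xs = _ ∷ _} _ {zero} {zero} _ = refl
lookup-injective (x∉xs ∷ _) {zero} {suc j} x≡xsⱼ = ⊥-elim (All.lookup x∉xs (∈-lookup j) x≡xsⱼ)
lookup-injective (x∉xs ∷ _) {suc i} {zero} xsᵢ≡x = ⊥-elim (All.lookup x∉xs (∈-lookup i) (sym xsᵢ≡x))
lookup-injective (_ ∷ unique) {suc i} {suc j} e = cong suc (lookup-injective unique e)

enumerate : ∀ {n} {Q : Fin n → Set} → Decidable Q → Enumeration Q
enumerate {n} Q? = record
  { size = length points
  ; point = lookup points
  ; point-injective = lookup-injective (filter⁺ Q? (allFin⁺ n))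
  ; point-sound = λ j → proj₂ (∈-filter⁻ Q? {xs = allFin n} (∈-lookup j))
  ; point-complete = λ x Qx → position (∈-filter⁺ Q? (∈-allFin x) Qx)
  }
  where
  points : List (Fin n)
  points = filter Q? (allFin n)
  position : ∀ {x} → x ∈ₗ points → ∃[ j ] (lookup points j ≡ x)
  position x∈ = index x∈ , sym (lookup-index x∈)

-- Generalities on bipartite posets and their isomorphisms.

Minimal : ∀ {n} → BipartitePoset n → Fin n → Set
Minimal P x = ∀ u → T (le P u x) → u ≡ x

order-iso : ∀ {n} (P Q : BipartitePoset n) (σ : Fin n ↔ Fin n) →
  (∀ x y → T (le P x y) ⇔ T (le Q (to σ x) (to σ y))) → PosetIso P Q
order-iso P Q σ σ-monotone = σ , λ x y → T-injective (σ-monotone x y)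

iso-∘ : ∀ {n} {P Q R : BipartitePoset n} → PosetIso P Q → PosetIso Q R → PosetIso P R
iso-∘ (σ , σ-iso) (σ′ , σ′-iso) =
  (σ′ ↔-∘ σ) , λ x y → ≡-trans (σ-iso x y) (σ′-iso (to σ x) (to σ y))

iso-sym : ∀ {n} {P Q : BipartitePoset n} → PosetIso P Q → PosetIso Q P
iso-sym {P = P} {Q} (σ , σ-iso) = ↔-sym σ , λ x y → begin
  le Q x y                                 ≡⟨ cong₂ (le Q) (inv x) (inv y) ⟨
  le Q (to σ (from σ x)) (to σ (from σ y)) ≡⟨ σ-iso (from σ x) (from σ y) ⟨
  le P (from σ x) (from σ y)               ∎
  where
  open ≡-Reasoning
  inv : ∀ x → to σ (from σ x) ≡ x
  inv = strictlyInverseˡ σ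

iso-minimal : ∀ {n} {P Q : BipartitePoset n} (iso : PosetIso P Q) {x} →
  Minimal P x → Minimal Q (to (proj₁ iso) x)
iso-minimal {P = P} {Q} (σ , σ-iso) {x} x-min u u≤σx = begin
  u               ≡⟨ strictlyInverseˡ σ u ⟨
  to σ (from σ u) ≡⟨ cong (to σ) (x-min (from σ u) (subst T (sym le≡) u≤σx)) ⟩
  to σ x          ∎
  where
  open ≡-Reasoning
  le≡ : le P (from σ u) x ≡ le Q u (to σ x)
  le≡ = ≡-trans (σ-iso (from σ u) x) (cong (λ v → le Q v (to σ x)) (strictlyInverseˡ σ u))

below⇒height0 : ∀ {n} (P : BipartitePoset n) {u y} → _≺_ P u y → Height0 P u
below⇒height0 P u≺y (w , w≺u) = height≤1 P w _ _ w≺u u≺y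

-- Transversals of minimal covers.

record Transversal {n} (C : MinSetCover n) : Set where
  field
    rep         : Fin (m C) → Fin n
    rep∈        : ∀ i → rep i ∈ member C i
    rep-private : ∀ i j → rep i ∈ member C j → j ≡ i

  rep-injective : Injective _≡_ _≡_ rep
  rep-injective {i} {j} ri≡rj = rep-private j i (subst (_∈ member C i) ri≡rj (rep∈ i))

-- By minimality, some element of C_i lies in no other member; a search
-- over Fin n finds one.
private-element : ∀ {n} (C : MinSetCover n) i →
  ∃[ x ] (x ∈ member C i × (∀ j → x ∈ member C j → j ≡ i))
private-element {n} C i = extract (¬∀⟶∃¬ n Shared shared? (minimal C i))
  where
  Shared : Fin n → Set
  Shared x = x ∈ member C i → ∃[ j ] (j ≢ i × x ∈ member C j)
  shared? : Decidable Shared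
  shared? x = x ∈? member C i →-dec any? (λ j → ¬? (j ≟ i) ×-dec x ∈? member C j)
  extract : ∃ (λ x → ¬ Shared x) → ∃[ x ] (x ∈ member C i × (∀ j → x ∈ member C j → j ≡ i))
  extract (x , unshared) =
    x , decidable-stable (x ∈? member C i) (λ x∉ → unshared (λ x∈ → ⊥-elim (x∉ x∈)))
      , λ j x∈j → decidable-stable (j ≟ i) (λ j≢i → unshared (λ _ → j , j≢i , x∈j))

transversal : ∀ {n} (C : MinSetCover n) → Transversal C
transversal C = record
  { rep = λ i → proj₁ (private-element C i)
  ; rep∈ = λ i → proj₁ (proj₂ (private-element C i))
  ; rep-private = λ i → proj₂ (proj₂ (private-element C i))
  }

module CoverPoset {n} (C : MinSetCover n) (t : Transversal C) where
  open Transversal t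

  IsRep : Fin n → Set
  IsRep x = ∃[ i ] (rep i ≡ x)

  isRep? : Decidable IsRep
  isRep? x = any? (λ i → rep i ≟ x)

  _≼_ : Fin n → Fin n → Set
  x ≼ y = x ≡ y ⊎ ∃[ i ] (rep i ≡ x × y ∈ member C i)

  _≼?_ : ∀ x y → Dec (x ≼ y)
  x ≼? y = x ≟ y ⊎-dec any? (λ i → rep i ≟ x ×-dec y ∈? member C i)

  -- Only r_j itself lies below r_j, since r_j is private to C_j.
  ≼-rep : ∀ {x} j → x ≼ rep j → x ≡ rep j
  ≼-rep j (inj₁ x≡rj) = x≡rj
  ≼-rep j (inj₂ (i , refl , rj∈i)) = cong rep (rep-private j i rj∈i)

  ≼-antisym : ∀ {x y} → x ≼ y → y ≼ x → x ≡ y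
  ≼-antisym (inj₁ x≡y) _ = x≡y
  ≼-antisym (inj₂ (i , refl , _)) y≼ri = sym (≼-rep i y≼ri)

  ≼-trans : ∀ {x y z} → x ≼ y → y ≼ z → x ≼ z
  ≼-trans (inj₁ refl) y≼z = y≼z
  ≼-trans x≼y (inj₁ refl) = x≼y
  ≼-trans (inj₂ (i , ri≡x , rj∈i)) (inj₂ (j , refl , z∈j)) =
    inj₂ (i , ri≡x , subst (λ k → _ ∈ member C k) (sym (rep-private j i rj∈i)) z∈j)

  -- No chain x ≺ y ≺ z: the middle element would be some r_j.
  ≼-height≤1 : ∀ {x y z} → x ≼ y → x ≢ y → y ≼ z → y ≢ z → ⊥
  ≼-height≤1 _ _ (inj₁ y≡z) y≢z = y≢z y≡z
  ≼-height≤1 x≼y x≢y (inj₂ (j , refl , _)) _ = x≢y (≼-rep j x≼y)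

  le≼ : Fin n → Fin n → Bool
  le≼ x y = isYes (x ≼? y)

  le⇔≼ : ∀ x y → T (le≼ x y) ⇔ x ≼ y
  le⇔≼ x y = mk⇔ (toWitness {a? = x ≼? y}) (fromWitness {a? = x ≼? y})

  poset : BipartitePoset n
  poset = record
    { le = le≼
    ; reflexive = λ x → backward (le⇔≼ x x) (inj₁ refl)
    ; antisym = λ x y x≤y y≤x → ≼-antisym (sound x≤y) (sound y≤x)
    ; trans = λ x y z x≤y y≤z → backward (le⇔≼ x z) (≼-trans (sound x≤y) (sound y≤z))
    ; height≤1 = λ x y z (x≤y , x≢y) (y≤z , y≢z) → ≼-height≤1 (sound x≤y) x≢y (sound y≤z) y≢z
    }
    where
    sound : ∀ {x y} → T (le≼ x y) → x ≼ y
    sound {x} {y} = forward (le⇔≼ x y)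

  rep≼⇔∈ : ∀ i x → rep i ≼ x ⇔ x ∈ member C i
  rep≼⇔∈ i x = mk⇔ up-set (λ x∈i → inj₂ (i , refl , x∈i))
    where
    up-set : rep i ≼ x → x ∈ member C i
    up-set (inj₁ refl) = rep∈ i
    up-set (inj₂ (j , rj≡ri , x∈j)) = subst (λ k → x ∈ member C k) (rep-injective rj≡ri) x∈j

  -- The minimal elements are exactly the representatives: a minimal x lies
  -- in some C_i, hence above r_i.
  rep⇔minimal : ∀ x → IsRep x ⇔ Minimal poset x
  rep⇔minimal x = mk⇔
    (λ { (j , refl) u u≤rj → ≼-rep j (forward (le⇔≼ u (rep j)) u≤rj) })
    (λ x-min → let (i , x∈i) = covers C x in
      i , x-min (rep i) (backward (le⇔≼ (rep i) x) (inj₂ (i , refl , x∈i))))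

  height1⇔non-rep : ∀ y → Height1 poset y ⇔ (¬ IsRep y)
  height1⇔non-rep y = mk⇔
    (λ { (u , u≤y , u≢y) (j , refl) → u≢y (≼-rep j (forward (le⇔≼ u (rep j)) u≤y)) })
    (λ non-rep → let (i , y∈i) = covers C y in
      rep i , backward (le⇔≼ (rep i) y) (inj₂ (i , refl , y∈i)) , λ ri≡y → non-rep (i , ri≡y))

  -- Constructively, height 0 gives a representative since IsRep is decidable.
  height0⇒rep : ∀ v → Height0 poset v → IsRep v
  height0⇒rep v h0 = decidable-stable (isRep? v) (h0 ∘ backward (height1⇔non-rep v))

  Full : Fin (m C) → Set
  Full i = ∀ x → x ∈ member C i ⊎ IsRep x

  -- If C_i is full, every height-1 point (a non-representative) lies in
  -- C_i, i.e. above r_i.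
  full⇒full-support : ∀ i → Full i → FullSupportPoint poset (rep i)
  full⇒full-support i full =
    (λ h1 → forward (height1⇔non-rep (rep i)) h1 (i , refl)) ,
    λ w h1 → inj₁ (backward (le⇔≼ (rep i) w) (inj₂ (i , refl , in-Cᵢ w h1)))
    where
    in-Cᵢ : ∀ w → Height1 poset w → w ∈ member C i
    in-Cᵢ w h1 with full w
    ... | inj₁ w∈i = w∈i
    ... | inj₂ w-rep = ⊥-elim (forward (height1⇔non-rep w) h1 w-rep)

  -- Conversely a non-representative x is comparable with r_i; it cannot be
  -- below r_i, so it lies above r_i, i.e. in C_i.
  full-support⇒full : ∀ i → FullSupportPoint poset (rep i) → Full i
  full-support⇒full i (_ , comparable) x with isRep? x
  ... | yes x-rep = inj₂ x-rep
  ... | no non-rep with comparable x (backward (height1⇔non-rep x) non-rep)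
  ...   | inj₁ ri≤x = inj₁ (forward (rep≼⇔∈ i x) (forward (le⇔≼ (rep i) x) ri≤x))
  ...   | inj₂ x≤ri = ⊥-elim (non-rep (i , sym (≼-rep i (forward (le⇔≼ x (rep i)) x≤ri))))

  -- A full support point has height 0, so it is some r_i, and C_i is full;
  -- by counting, full members are exactly those of size n + 1 - |C|.
  unbalanced⇔ : UnbalancedCover C ⇔ UnbalancedPoset poset
  unbalanced⇔ = mk⇔
    (λ (i , size) → rep i , full⇒full-support i (forward (size⇔full i) size))
    (λ { (v , v-full) → unbalanced-rep v v-full (height0⇒rep v (proj₁ v-full)) })
    where
    size⇔full : ∀ i → ∣ member C i ∣ + m C ≡ n + 1 ⇔ Full i
    size⇔full = member-size⇔ (member C) rep rep∈ rep-private
    unbalanced-rep : ∀ v → FullSupportPoint poset v → IsRep v → UnbalancedCover C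
    unbalanced-rep v v-full (i , refl) = i , backward (size⇔full i) (full-support⇒full i v-full)

open CoverPoset using (poset)

-- Cover isomorphisms and the independence of the transversal.

module CoverIsoTransport {n} {C D : MinSetCover n} (iso : CoverIso C D) where
  σ : Fin n ↔ Fin n
  σ = proj₁ iso
  τ : Fin (m C) ↔ Fin (m D)
  τ = proj₁ (proj₂ iso)

  ∈⇔ : ∀ i x → x ∈ member C i ⇔ to σ x ∈ member D (to τ i)
  ∈⇔ i x = mk⇔ (proj₁ (proj₂ (proj₂ iso) i x)) (proj₂ (proj₂ (proj₂ iso) i x))

  ∈⇔′ : ∀ j x → x ∈ member C (from τ j) ⇔ to σ x ∈ member D j
  ∈⇔′ j x = subst (λ k → x ∈ member C (from τ j) ⇔ to σ x ∈ member D k)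
                  (strictlyInverseˡ τ j) (∈⇔ (from τ j) x)

  transport : Transversal C → Transversal D
  transport t = record
    { rep = λ j → to σ (rep (from τ j))
    ; rep∈ = λ j → forward (∈⇔′ j _) (rep∈ (from τ j))
    ; rep-private = λ j k σrⱼ∈k →
        ↔-injective (↔-sym τ) (rep-private (from τ j) (from τ k) (backward (∈⇔′ k _) σrⱼ∈k))
    }
    where open Transversal t

  transport-rep : ∀ t i → to σ (Transversal.rep t i) ≡ Transversal.rep (transport t) (to τ i)
  transport-rep t i = cong (to σ ∘ Transversal.rep t) (sym (strictlyInverseʳ τ i))

  module _ (t : Transversal C) (t′ : Transversal D)
           (σr≡r′τ : ∀ i → to σ (Transversal.rep t i) ≡ Transversal.rep t′ (to τ i)) where
    private
      module A = CoverPoset C t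
      module B = CoverPoset D t′

    ≼-preserve : ∀ {x y} → x A.≼ y → to σ x B.≼ to σ y
    ≼-preserve (inj₁ refl) = inj₁ refl
    ≼-preserve {y = y} (inj₂ (i , refl , y∈i)) = inj₂ (to τ i , sym (σr≡r′τ i) , forward (∈⇔ i y) y∈i)

    ≼-reflect : ∀ {x y} → to σ x B.≼ to σ y → x A.≼ y
    ≼-reflect (inj₁ σx≡σy) = inj₁ (↔-injective σ σx≡σy)
    ≼-reflect {x} {y} (inj₂ (j , r′ⱼ≡σx , σy∈j)) =
      inj₂ (from τ j , ↔-injective σ σr≡σx , backward (∈⇔′ j y) σy∈j)
      where
      open ≡-Reasoning
      σr≡σx : to σ (Transversal.rep t (from τ j)) ≡ to σ x
      σr≡σx = begin
        to σ (Transversal.rep t (from τ j))   ≡⟨ σr≡r′τ (from τ j) ⟩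
        Transversal.rep t′ (to τ (from τ j))  ≡⟨ cong (Transversal.rep t′) (strictlyInverseˡ τ j) ⟩
        Transversal.rep t′ j                  ≡⟨ r′ⱼ≡σx ⟩
        to σ x                                ∎

    poset-iso : PosetIso (poset C t) (poset D t′)
    poset-iso = order-iso (poset C t) (poset D t′) σ λ x y → begin
      T (A.le≼ x y)                 ≈⟨ A.le⇔≼ x y ⟩
      x A.≼ y                       ≈⟨ mk⇔ ≼-preserve ≼-reflect ⟩
      to σ x B.≼ to σ y             ≈⟨ B.le⇔≼ (to σ x) (to σ y) ⟨
      T (B.le≼ (to σ x) (to σ y))   ∎
      where open ⇔-Reasoning

-- The involution exchanging r₁ i with r₂ i (and fixing everything else)
-- preserves every member, so the poset does not depend on the transversal.
module Exchange {n} (C : MinSetCover n) (t₁ t₂ : Transversal C) where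
  open Transversal
  module R₁ = CoverPoset C t₁
  module R₂ = CoverPoset C t₂

  exchange : Fin n → Fin n
  exchange x with R₁.isRep? x
  ... | yes (i , _) = rep t₂ i
  ... | no _ with R₂.isRep? x
  ...   | yes (i , _) = rep t₁ i
  ...   | no _ = x

  private-index : ∀ (t : Transversal C) {i k x} → rep t k ≡ x → x ∈ member C i → k ≡ i
  private-index t {i} rk≡x x∈i = sym (rep-private t _ i (subst (_∈ member C i) (sym rk≡x) x∈i))

  exchange₁ : ∀ i → exchange (rep t₁ i) ≡ rep t₂ i
  exchange₁ i with R₁.isRep? (rep t₁ i)
  ... | yes (k , r₁k≡r₁i) = cong (rep t₂) (rep-injective t₁ r₁k≡r₁i)
  ... | no non-rep = ⊥-elim (non-rep (i , refl))

  exchange₂ : ∀ i → exchange (rep t₂ i) ≡ rep t₁ i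
  exchange₂ i with R₁.isRep? (rep t₂ i)
  ... | yes (k , r₁k≡r₂i) with refl ← private-index t₁ r₁k≡r₂i (rep∈ t₂ i) = sym r₁k≡r₂i
  ... | no _ with R₂.isRep? (rep t₂ i)
  ...   | yes (k , r₂k≡r₂i) = cong (rep t₁) (rep-injective t₂ r₂k≡r₂i)
  ...   | no non-rep = ⊥-elim (non-rep (i , refl))

  exchange-involutive : ∀ x → exchange (exchange x) ≡ x
  exchange-involutive x with R₁.isRep? x
  ... | yes (i , refl) = exchange₂ i
  ... | no non-rep₁ with R₂.isRep? x
  ...   | yes (i , refl) = exchange₁ i
  ...   | no non-rep₂ = fixed
    where
    fixed : exchange x ≡ x
    fixed with R₁.isRep? x
    ... | yes x-rep = ⊥-elim (non-rep₁ x-rep)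
    ... | no _ with R₂.isRep? x
    ...   | yes x-rep = ⊥-elim (non-rep₂ x-rep)
    ...   | no _ = refl

  -- A representative lying in C_i is r₁ i or r₂ i, and both lie in C_i.
  exchange-∈ : ∀ i x → x ∈ member C i → exchange x ∈ member C i
  exchange-∈ i x x∈i with R₁.isRep? x
  ... | yes (k , r₁k≡x) = subst (λ l → rep t₂ k ∈ member C l) (private-index t₁ r₁k≡x x∈i) (rep∈ t₂ k)
  ... | no _ with R₂.isRep? x
  ...   | yes (k , r₂k≡x) = subst (λ l → rep t₁ k ∈ member C l) (private-index t₂ r₂k≡x x∈i) (rep∈ t₁ k)
  ...   | no _ = x∈i

  exchange-iso : CoverIso C C
  exchange-iso = exchange↔ , ↔-id _ , λ i x → exchange-∈ i x , exchange-∈⁻¹ i x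
    where
    exchange↔ : Fin n ↔ Fin n
    exchange↔ = mk↔ₛ′ exchange exchange exchange-involutive exchange-involutive
    exchange-∈⁻¹ : ∀ i x → exchange x ∈ member C i → x ∈ member C i
    exchange-∈⁻¹ i x ex∈i =
      subst (_∈ member C i) (exchange-involutive x) (exchange-∈ i (exchange x) ex∈i)

  independent : PosetIso (poset C t₁) (poset C t₂)
  independent = CoverIsoTransport.poset-iso exchange-iso t₁ t₂ exchange₁

-- The image of a representative under a poset isomorphism is a
-- representative, as representatives are the minimal elements.
rep-image : ∀ {n} {C D : MinSetCover n} (t : Transversal C) (t′ : Transversal D)
  (iso : PosetIso (poset C t) (poset D t′)) →
  ∀ i → ∃[ j ] (Transversal.rep t′ j ≡ to (proj₁ iso) (Transversal.rep t i))
rep-image {C = C} {D} t t′ iso i =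
  backward (B.rep⇔minimal _)
    (iso-minimal {P = A.poset} {Q = B.poset} iso (forward (A.rep⇔minimal _) (i , refl)))
  where
  module A = CoverPoset C t
  module B = CoverPoset D t′

-- A poset isomorphism σ between the posets of two covers is a cover
-- isomorphism: σ matches representatives, giving the bijection τ of indices,
-- and it maps the up-set of r_i, namely C_i, onto the up-set D_(τ i).
cover-iso : ∀ {n} {C D : MinSetCover n} (t : Transversal C) (t′ : Transversal D) →
  PosetIso (poset C t) (poset D t′) → CoverIso C D
cover-iso {C = C} {D} t t′ iso@(σ , σ-iso) =
  σ , τ , λ i x → forward (member⇔ i x) , backward (member⇔ i x)
  where
  module A = CoverPoset C t
  module B = CoverPoset D t′
  open Transversal
  iso⁻¹ : PosetIso B.poset A.poset
  iso⁻¹ = iso-sym {P = A.poset} {Q = B.poset} iso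
  f : Fin (m C) → Fin (m D)
  f i = proj₁ (rep-image t t′ iso i)
  g : Fin (m D) → Fin (m C)
  g j = proj₁ (rep-image t′ t iso⁻¹ j)
  f-rep : ∀ i → rep t′ (f i) ≡ to σ (rep t i)
  f-rep i = proj₂ (rep-image t t′ iso i)
  g-rep : ∀ j → rep t (g j) ≡ from σ (rep t′ j)
  g-rep j = proj₂ (rep-image t′ t iso⁻¹ j)
  f∘g : ∀ j → f (g j) ≡ j
  f∘g j = rep-injective t′ (begin
    rep t′ (f (g j))         ≡⟨ f-rep (g j) ⟩
    to σ (rep t (g j))       ≡⟨ cong (to σ) (g-rep j) ⟩
    to σ (from σ (rep t′ j)) ≡⟨ strictlyInverseˡ σ (rep t′ j) ⟩
    rep t′ j                 ∎)
    where open ≡-Reasoning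
  g∘f : ∀ i → g (f i) ≡ i
  g∘f i = rep-injective t (begin
    rep t (g (f i))          ≡⟨ g-rep (f i) ⟩
    from σ (rep t′ (f i))    ≡⟨ cong (from σ) (f-rep i) ⟩
    from σ (to σ (rep t i))  ≡⟨ strictlyInverseʳ σ (rep t i) ⟩
    rep t i                  ∎)
    where open ≡-Reasoning
  τ : Fin (m C) ↔ Fin (m D)
  τ = mk↔ₛ′ f g f∘g g∘f
  member⇔ : ∀ i x → x ∈ member C i ⇔ to σ x ∈ member D (f i)
  member⇔ i x = begin
    x ∈ member C i                             ≈⟨ A.rep≼⇔∈ i x ⟨
    rep t i A.≼ x                              ≈⟨ A.le⇔≼ (rep t i) x ⟨
    T (A.le≼ (rep t i) x)                      ≡⟨ cong T (σ-iso (rep t i) x) ⟩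
    T (B.le≼ (to σ (rep t i)) (to σ x))        ≡⟨ cong (λ r → T (B.le≼ r (to σ x))) (f-rep i) ⟨
    T (B.le≼ (rep t′ (f i)) (to σ x))          ≈⟨ B.le⇔≼ (rep t′ (f i)) (to σ x) ⟩
    rep t′ (f i) B.≼ to σ x                    ≈⟨ B.rep≼⇔∈ (f i) (to σ x) ⟩
    to σ x ∈ member D (f i)                    ∎
    where open ⇔-Reasoning

-- Every bipartite poset P arises: the up-sets of its height-0 points form a
-- minimal cover, the height-0 points are a transversal of it, and the poset
-- of that cover is P itself.
module Realisation {n} (P : BipartitePoset n) where
  height1? : Decidable (Height1 P)
  height1? y = any? (λ u → T? (le P u y) ×-dec ¬? (u ≟ y))

  open Enumeration (enumerate {Q = Height0 P} (¬? ∘ height1?))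
    renaming (size to k; point to base; point-injective to base-injective;
              point-sound to base-height0; point-complete to base-complete)

  up : Fin n → Subset n
  up x = tabulate (le P x)

  ∈up : ∀ {x y} → T (le P x y) → y ∈ up x
  ∈up {x} {y} = backward (∈-tabulate (le P x) y)

  base∈ : ∀ i → base i ∈ up (base i)
  base∈ i = ∈up (reflexive P (base i))

  base-private : ∀ i j → base i ∈ up (base j) → j ≡ i
  base-private i j bᵢ∈ with base j ≟ base i
  ... | yes bⱼ≡bᵢ = base-injective bⱼ≡bᵢ
  ... | no bⱼ≢bᵢ = ⊥-elim (base-height0 i (base j , forward (∈-tabulate _ _) bᵢ∈ , bⱼ≢bᵢ))

  above-base : ∀ y → ∃[ j ] (y ∈ up (base j))
  above-base y with height1? y
  ... | no h0 = let (j , bⱼ≡y) = base-complete y h0 in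
    j , ∈up (subst (λ b → T (le P b y)) (sym bⱼ≡y) (reflexive P y))
  ... | yes (u , u≺y) = let (j , bⱼ≡u) = base-complete u (below⇒height0 P u≺y) in
    j , ∈up (subst (λ b → T (le P b y)) (sym bⱼ≡u) (proj₁ u≺y))

  cover : MinSetCover n
  cover = record
    { m = k
    ; member = up ∘ base
    ; covers = above-base
    ; minimal = λ i redundant →
        let (j , j≢i , bᵢ∈j) = redundant (base i) (base∈ i) in j≢i (base-private i j bᵢ∈j)
    }

  bases : Transversal cover
  bases = record { rep = base ; rep∈ = base∈ ; rep-private = base-private }

  open CoverPoset cover bases using (_≼_)

  -- The cover poset has the order of P: if x < y then x has height 0, so
  -- it is a base and y lies in its up-set.
  ≼⇔le : ∀ x y → x ≼ y ⇔ T (le P x y)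
  ≼⇔le x y = mk⇔ sound complete
    where
    sound : x ≼ y → T (le P x y)
    sound (inj₁ refl) = reflexive P x
    sound (inj₂ (j , refl , y∈)) = forward (∈-tabulate _ _) y∈
    complete : T (le P x y) → x ≼ y
    complete x≤y with x ≟ y
    ... | yes x≡y = inj₁ x≡y
    ... | no x≢y = let (j , bⱼ≡x) = base-complete x (below⇒height0 P (x≤y , x≢y)) in
      inj₂ (j , bⱼ≡x , ∈up (subst (λ b → T (le P b y)) (sym bⱼ≡x) x≤y))

  realises : PosetIso (poset cover bases) P
  realises = order-iso (poset cover bases) P (↔-id _) λ x y →
    mk⇔ (forward (≼⇔le x y) ∘ forward (le⇔≼ x y))
        (backward (le⇔≼ x y) ∘ backward (≼⇔le x y))
    where open CoverPoset cover bases using (le⇔≼)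

-- The correspondence of Theorem 5.1.

F : ∀ {n} → MinSetCover n → BipartitePoset n
F C = poset C (transversal C)

-- Transport the canonical transversal of C to D, then exchange it for the
-- canonical transversal of D.
F-respects-iso : ∀ {n} (C D : MinSetCover n) → CoverIso C D → PosetIso (F C) (F D)
F-respects-iso C D iso = iso-∘ {P = F C} {Q = poset D t′} {R = F D} transported exchanged
  where
  open CoverIsoTransport {C = C} {D} iso
  t′ : Transversal D
  t′ = transport (transversal C)
  transported : PosetIso (F C) (poset D t′)
  transported = poset-iso (transversal C) t′ (transport-rep (transversal C))
  exchanged : PosetIso (poset D t′) (F D)
  exchanged = Exchange.independent D t′ (transversal D)

F-reflects-iso : ∀ {n} (C D : MinSetCover n) → PosetIso (F C) (F D) → CoverIso C D
F-reflects-iso C D = cover-iso (transversal C) (transversal D)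

F-surjective : ∀ {n} (P : BipartitePoset n) → ∃[ C ] PosetIso (F C) P
F-surjective P = cover , iso-∘ {P = F cover} {Q = poset cover bases} {R = P} exchanged realises
  where
  open Realisation P
  exchanged : PosetIso (F cover) (poset cover bases)
  exchanged = Exchange.independent cover (transversal cover) bases

F-unbalanced : ∀ {n} (C : MinSetCover n) → UnbalancedCover C ⇔ UnbalancedPoset (F C)
F-unbalanced C = CoverPoset.unbalanced⇔ C (transversal C)

theorem5p1 : (n : ℕ) →
    Σ (MinSetCover n → BipartitePoset n) λ F →
      (∀ C D → CoverIso C D → PosetIso (F C) (F D)) ×
      (∀ C D → PosetIso (F C) (F D) → CoverIso C D) ×
      (∀ (P : BipartitePoset n) → ∃[ C ] PosetIso (F C) P) ×
      (∀ C → UnbalancedCover C ⇔ UnbalancedPoset (F C)) ×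
      (∀ C → BalancedCover C ⇔ BalancedPoset (F C))
theorem5p1 n =
  F , F-respects-iso , F-reflects-iso , F-surjective , F-unbalanced , λ C → ¬-cong-⇔ (F-unbalanced C)
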